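{- Let $G$ be a profinite subgroup of $S_\infty$, let $k<l$, and let $\alpha^-(\bar x)$ be a negative formula in the language of groups. Then for every tuple $\bar g$ of elements of $G$, $G_k\models\alpha^-(\bar g_k)$ implies $G_l\models\alpha^-(\bar g_l)$.
   Context: $S_\infty$ is the group of all permutations of $\mathbb{N}$, with the topology of pointwise convergence; its profinite subgroups are exactly the closed subgroups all of whose orbits $\mathrm{orb}_G(n)=\{g(n):g\in G\}$ are finite. The orbits of a profinite $G$ are enumerated as $O_{G,0}=\mathrm{orb}_G(0)$ and $O_{G,n+1}=$ the orbit of the least natural number not in any $O_{G,m}$, $m\le n$. For $g\in G$ and $k\in\mathbb{N}$, $g_k=g\restriction\bigcup_{i\le k}O_{G,i}$ (applied coordinatewise to tuples), and $G_k=\{g_k:g\in G\}$, a finite group under composition. A positive formula is a first-order formula built from atomic formulas using only $\wedge$, $\vee$ and quantifiers (no negation); a negative formula is the negation of a positive formula. -}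

module Defs where

open import Data.Nat using (ℕ; zero; suc; _<_)
open import Data.Fin using (Fin)
open import Data.List using (List; []; _∷_; _++_; [_])
open import Data.List.Membership.Propositional using (_∈_)
open import Data.Product using (Σ; ∃; ∃-syntax; _×_; _,_; proj₁)
open import Data.Sum using (_⊎_)
open import Relation.Nullary using (¬_)
open import Relation.Binary.PropositionalEquality using (_≡_)
open import Function.Bundles using (_⇔_)

record Perm : Set where
  field
    fun : ℕ → ℕ
    inv : ℕ → ℕ
    inv-fun : ∀ n → inv (fun n) ≡ n
    fun-inv : ∀ n → fun (inv n) ≡ n
open Perm public

idP : Perm
idP = record { fun = λ n → n ; inv = λ n → n
             ; inv-fun = λ _ → Relation.Binary.PropositionalEquality.refl
             ; fun-inv = λ _ → Relation.Binary.PropositionalEquality.refl }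

_∘P_ : Perm → Perm → Perm
g ∘P h = record
  { fun = λ n → fun g (fun h n)
  ; inv = λ n → inv h (inv g n)
  ; inv-fun = λ n → Relation.Binary.PropositionalEquality.trans
                      (Relation.Binary.PropositionalEquality.cong (inv h) (inv-fun g (fun h n)))
                      (inv-fun h n)
  ; fun-inv = λ n → Relation.Binary.PropositionalEquality.trans
                      (Relation.Binary.PropositionalEquality.cong (fun g) (fun-inv h (inv g n)))
                      (fun-inv g n)
  }

_⁻¹P : Perm → Perm
g ⁻¹P = record { fun = inv g ; inv = fun g ; inv-fun = fun-inv g ; fun-inv = inv-fun g }

record IsSubgroup (G : Perm → Set) : Set where
  field
    has-id  : G idP
    has-∘   : ∀ {g h} → G g → G h → G (g ∘P h)
    has-inv : ∀ {g} → G g → G (g ⁻¹P)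

-- closed in the topology of pointwise convergence: any permutation p
-- such that every basic neighbourhood {q | ∀ m < n, q m = p m} meets G lies in G
IsClosed : (Perm → Set) → Set
IsClosed G = ∀ (p : Perm) →
  (∀ n → ∃[ g ] (G g × (∀ m → m < n → fun g m ≡ fun p m))) → G p

orb : (Perm → Set) → ℕ → ℕ → Set
orb G n m = ∃[ g ] (G g × fun g n ≡ m)

FiniteOrbits : (Perm → Set) → Set
FiniteOrbits G = ∀ n → Σ (List ℕ) λ L → ∀ m → (m ∈ L ⇔ orb G n m)

record IsProfinite (G : Perm → Set) : Set where
  field
    subgroup : IsSubgroup G
    closed   : IsClosed G
    finite   : FiniteOrbits G

Covered : (Perm → Set) → List ℕ → ℕ → Set
Covered G rs m = ∃[ r ] (r ∈ rs × orb G r m)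

-- Reps G k rs : rs = r_0 , ... , r_k where O_{G,i} = orb_G(r_i),
-- r_0 = 0 and r_{i+1} = least natural number not in ⋃_{j ≤ i} O_{G,j}
data Reps (G : Perm → Set) : ℕ → List ℕ → Set where
  base : Reps G zero [ 0 ]
  step : ∀ {k rs m} → Reps G k rs → ¬ Covered G rs m →
         (∀ j → j < m → Covered G rs j) → Reps G (suc k) (rs ++ [ m ])

InU : (Perm → Set) → ℕ → ℕ → Set
InU G k x = ∃[ rs ] (Reps G k rs × Covered G rs x)

_≈[_,_]_ : Perm → (Perm → Set) → ℕ → Perm → Set
g ≈[ G , k ] h = ∀ x → InU G k x → fun g x ≡ fun h x

data Term (n : ℕ) : Set where
  var  : Fin n → Term n
  e    : Term n
  _·_  : Term n → Term n → Term n
  _⁻¹  : Term n → Term n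

data Pos : ℕ → Set where
  _≐_  : ∀ {n} → Term n → Term n → Pos n
  _∧_  : ∀ {n} → Pos n → Pos n → Pos n
  _∨_  : ∀ {n} → Pos n → Pos n → Pos n
  ∃'   : ∀ {n} → Pos (suc n) → Pos n
  ∀'   : ∀ {n} → Pos (suc n) → Pos n

Elem : (Perm → Set) → Set
Elem G = Σ Perm G

extend : ∀ {A : Set} {n} → A → (Fin n → A) → Fin (suc n) → A
extend a ρ Fin.zero    = a
extend a ρ (Fin.suc i) = ρ i

evalT : ∀ {n} → Term n → (Fin n → Perm) → Perm
evalT (var i) ρ = ρ i
evalT e ρ = idP
evalT (s · t) ρ = evalT s ρ ∘P evalT t ρ
evalT (t ⁻¹) ρ = (evalT t ρ) ⁻¹P

-- G_k ⊨ φ(ḡ_k).  Elements of G_k are the g_k for g ∈ G, equality in G_k is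
-- equality of restrictions, and t(ḡ_k) = (t(ḡ))_k.
Sat : (G : Perm → Set) → ℕ → ∀ {n} → Pos n → (Fin n → Elem G) → Set
Sat G k (s ≐ t) ρ = evalT s (λ i → proj₁ (ρ i)) ≈[ G , k ] evalT t (λ i → proj₁ (ρ i))
Sat G k (φ ∧ ψ) ρ = Sat G k φ ρ × Sat G k ψ ρ
Sat G k (φ ∨ ψ) ρ = Sat G k φ ρ ⊎ Sat G k ψ ρ
Sat G k (∃' φ) ρ = Σ (Elem G) λ g → Sat G k φ (extend g ρ)
Sat G k (∀' φ) ρ = (g : Elem G) → Sat G k φ (extend g ρ)

-- a negative formula is ¬φ with φ positive:  G_k ⊨ ¬φ(ḡ_k)
SatNeg : (G : Perm → Set) → ℕ → ∀ {n} → Pos n → (Fin n → Elem G) → Set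
SatNeg G k φ ρ = ¬ Sat G k φ ρ

{-# OPTIONS --safe #-}
-- Restriction g_l ↦ g_k is a surjective homomorphism G_l → G_k, and positive formulas are
-- preserved under surjective homomorphisms; so G_l ⊨ φ(ḡ_l) implies G_k ⊨ φ(ḡ_k) for
-- positive φ, which is the contrapositive of the claim.  Atomically this only needs
-- ⋃_{i ≤ k} O_{G,i} ⊆ ⋃_{i ≤ l} O_{G,i}, i.e. that the orbit enumeration never gets stuck:
-- as orbits are finite, membership in finitely many of them is decidable and bounded, so a
-- least uncovered point always exists.
module Submission where

open import Defs
open import Data.Nat using (ℕ; zero; suc; _≤_; _<_; _≤′_; ≤′-refl; ≤′-step; _⊔_; s≤s)
open import Data.Nat.Properties
  using (_≟_; <-irrefl; <⇒≤; ≤⇒≤′; m<1+n⇒m<n∨m≡n; m<n⇒m<n⊔o; m<n⇒m<o⊔n; n<1+n)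
open import Data.Fin using (Fin)
open import Data.List using (List; []; _∷_; _++_; [_])
open import Data.List.Extrema.Nat using (max; xs≤max)
open import Data.List.Membership.Propositional using (_∈_; find; lose)
open import Data.List.Membership.DecPropositional _≟_ using (_∈?_)
open import Data.List.Membership.Propositional.Properties using (∈-++⁺ˡ)
open import Data.List.Relation.Unary.All as All using ()
open import Data.List.Relation.Unary.Any using (here; there; any?)
open import Data.Product using (∃-syntax; _×_; _,_)
open import Data.Sum using (_⊎_; inj₁; inj₂; [_,_]′)
open import Data.Empty using (⊥-elim)
open import Relation.Nullary using (¬_; yes; no)
open import Relation.Nullary.Decidable using (map′)
open import Relation.Unary using (Pred; Decidable)
open import Relation.Binary.PropositionalEquality using (refl)
open import Function.Bundles using (Equivalence)

module _ {p} {P : Pred ℕ p} (P? : Decidable P) where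

  LeastCounterexample : Set p
  LeastCounterexample = ∃[ m ] (¬ P m × (∀ j → j < m → P j))

  all-below-or-least-counterexample : ∀ n → (∀ {j} → j < n → P j) ⊎ LeastCounterexample
  all-below-or-least-counterexample zero = inj₁ λ ()
  all-below-or-least-counterexample (suc n) with all-below-or-least-counterexample n | P? n
  ... | inj₂ least | _      = inj₂ least
  ... | inj₁ below | no ¬Pn = inj₂ (n , ¬Pn , λ _ → below)
  ... | inj₁ below | yes Pn = inj₁ λ j<1+n → [ below , (λ { refl → Pn }) ]′ (m<1+n⇒m<n∨m≡n j<1+n)

  least-counterexample : ∀ {n} → ¬ P n → LeastCounterexample
  least-counterexample {n} ¬Pn with all-below-or-least-counterexample (suc n)
  ... | inj₁ below = ⊥-elim (¬Pn (below (n<1+n n)))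
  ... | inj₂ least = least

list-bounded : (L : List ℕ) → ∃[ B ] (∀ {m} → m ∈ L → m < B)
list-bounded L = suc (max 0 L) , λ m∈L → s≤s (All.lookup (xs≤max 0 L) m∈L)

module _ {G : Perm → Set} (finite : FiniteOrbits G) where

  orb? : ∀ r → Decidable (orb G r)
  orb? r m with finite r
  ... | L , orbit-is-L = map′ (Equivalence.to (orbit-is-L m)) (Equivalence.from (orbit-is-L m)) (m ∈? L)

  Covered? : ∀ rs → Decidable (Covered G rs)
  Covered? rs m = map′ find (λ (_ , r∈rs , o) → lose r∈rs o) (any? (λ r → orb? r m) rs)

  orb-bounded : ∀ r → ∃[ B ] (∀ {m} → orb G r m → m < B)
  orb-bounded r with finite r
  ... | L , orbit-is-L with list-bounded L
  ...   | B , bound = B , λ {m} o → bound (Equivalence.from (orbit-is-L m) o)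

  Covered-bounded : ∀ rs → ∃[ B ] (∀ {m} → Covered G rs m → m < B)
  Covered-bounded [] = 0 , λ { (_ , () , _) }
  Covered-bounded (r ∷ rs) with orb-bounded r | Covered-bounded rs
  ... | B₁ , bound₁ | B₂ , bound₂ = B₁ ⊔ B₂ , λ where
    (_ , here refl , o)    → m<n⇒m<n⊔o B₂ (bound₁ o)
    (r′ , there r′∈rs , o) → m<n⇒m<o⊔n B₁ (bound₂ (r′ , r′∈rs , o))

  Reps-suc : ∀ {k rs} → Reps G k rs → ∃[ m ] Reps G (suc k) (rs ++ [ m ])
  Reps-suc {rs = rs} R with Covered-bounded rs
  ... | B , bound with least-counterexample (Covered? rs) (λ c → <-irrefl refl (bound {B} c))
  ...   | m , uncovered , below = m , step R uncovered below

  InU-suc : ∀ {k x} → InU G k x → InU G (suc k) x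
  InU-suc (rs , R , r , r∈rs , o) with Reps-suc R
  ... | m , R′ = rs ++ [ m ] , R′ , r , ∈-++⁺ˡ r∈rs , o

  InU-mono : ∀ {k l x} → k ≤ l → InU G k x → InU G l x
  InU-mono k≤l = go (≤⇒≤′ k≤l)
    where
    go : ∀ {k l x} → k ≤′ l → InU G k x → InU G l x
    go ≤′-refl        u = u
    go (≤′-step k≤l) u = InU-suc (go k≤l u)

Sat-antitone : ∀ {G k l} → (∀ {x} → InU G k x → InU G l x) →
  ∀ {n} (α : Pos n) (gs : Fin n → Elem G) → Sat G l α gs → Sat G k α gs
Sat-antitone k⊆l (s ≐ t) gs s≈t      = λ x u → s≈t x (k⊆l u)
Sat-antitone k⊆l (α ∧ β) gs (a , b)  = Sat-antitone k⊆l α gs a , Sat-antitone k⊆l β gs b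
Sat-antitone k⊆l (α ∨ β) gs (inj₁ a) = inj₁ (Sat-antitone k⊆l α gs a)
Sat-antitone k⊆l (α ∨ β) gs (inj₂ b) = inj₂ (Sat-antitone k⊆l β gs b)
Sat-antitone k⊆l (∃' α)  gs (g , a)  = g , Sat-antitone k⊆l α (extend g gs) a
Sat-antitone k⊆l (∀' α)  gs a        = λ g → Sat-antitone k⊆l α (extend g gs) (a g)

corollary1 : (G : Perm → Set) → IsProfinite G → (k l : ℕ) → k < l →
    (n : ℕ) (α : Pos n) (gs : Fin n → Elem G) →
    SatNeg G k α gs → SatNeg G l α gs
corollary1 G P k l k<l n α gs ¬k-sat l-sat =
  ¬k-sat (Sat-antitone (InU-mono (IsProfinite.finite P) (<⇒≤ k<l)) α gs l-sat)
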